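{- Let $\operatorname{Gc}$ be an acceptable code, let $\beta\in\mathfrak S_n$ and $k\ge1$. The set of nondecreasing rearrangements of the first $k$ components of $\operatorname{Gc}(\sigma)$, for $\sigma\in\operatorname{id}_k\Cup\beta$, is exactly the set of all sequences $(i_1,\ldots,i_k)$ with $0\le i_1\le\cdots\le i_k\le n$. In particular $$\sum_{\sigma\in\operatorname{id}_k\Cup\beta}x_{\operatorname{Gc}(\sigma)}=h_k(X_n)\,x_{\operatorname{Gc}(\beta)}.$$
   Context: Permutations are words. A sequence $(a_1,\ldots,a_m)$ is sub-diagonal if $0\le a_i\le m-i$. A code is a family of bijections $\operatorname{Gc}$ from $\mathfrak S_m$ onto sub-diagonal sequences of length $m$, for all $m$. For $\gamma\in\mathfrak S_m$ and $0\le i\le m$, $1\Cup_i\gamma\in\mathfrak S_{m+1}$ is obtained by adding $1$ to every letter of $\gamma$ and inserting the letter $1$ at position $i+1$. $\operatorname{Gc}$ is compatible with the shuffle if $\operatorname{Gc}(1\Cup_i\gamma)=(t,\operatorname{Gc}(\gamma))$ for some integer $t$, for all $\gamma,i$; then $\tau_G(\gamma)$ is the permutation of $\{0,\ldots,m\}$ sending $i$ to the first entry of $\operatorname{Gc}(1\Cup_i\gamma)$. Such a code is acceptable if for all $\gamma\in\mathfrak S_m$ and $k\in[0,m]$, with $\gamma'=1\Cup_k\gamma$, $\{\tau_G(\gamma')(i):i\in[0,k]\}=\{\tau_G(\gamma)(i):i\in[0,k]\}$. $\operatorname{id}_k\Cup\beta$ is the set of permutations of $[n+k]$ obtained by shuffling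 $12\cdots k$ with $(\beta(1)+k)\cdots(\beta(n)+k)$. $x_0,x_1,\ldots$ commuting indeterminates, $x_c=x_{c_1}\cdots x_{c_m}$, $X_n=\{x_0,\ldots,x_n\}$, $h_k(X_n)$ the complete homogeneous symmetric polynomial of degree $k$ in $X_n$. -}

module Defs where

open import Level using (0ℓ)
open import Data.Nat using (ℕ; zero; suc; _+_; _∸_; _≤_)
open import Data.List using (List; []; _∷_; _++_; map; take; drop; length; upTo; concatMap; foldr)
open import Data.List.Relation.Binary.Permutation.Propositional using (_↭_)
open import Data.List.Relation.Unary.Linked using (Linked)
open import Data.Product using (Σ; ∃; _×_)
open import Data.Unit using (⊤)
open import Function.Bundles using (_⇔_)
open import Relation.Binary.PropositionalEquality using (_≡_)
open import Algebra.Bundles using (CommutativeSemiring)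

-- Permutations of [m] are words: lists containing each of 1,…,m exactly once.
oneTo : ℕ → List ℕ
oneTo m = map suc (upTo m)

IsPerm : ℕ → List ℕ → Set
IsPerm m w = w ↭ oneTo m

-- sub-diagonal: a_i ≤ m - i  (i 1-based), i.e. head ≤ length of the tail
SD : List ℕ → Set
SD []      = ⊤
SD (a ∷ s) = (a ≤ length s) × SD s

SubDiag : ℕ → List ℕ → Set
SubDiag m s = (length s ≡ m) × SD s

-- 1 ∪_i γ : add 1 to every letter, insert letter 1 at position i+1
ins : ℕ → List ℕ → List ℕ
ins i γ = take i (map suc γ) ++ (1 ∷ drop i (map suc γ))

-- A code: for every m, Gc restricted to S_m is a bijection onto sub-diagonal
-- sequences of length m (values of Gc on non-permutation words are irrelevant).
record Code : Set where
  field
    Gc     : List ℕ → List ℕ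
    into   : ∀ m w → IsPerm m w → SubDiag m (Gc w)
    inj    : ∀ m w w' → IsPerm m w → IsPerm m w' → Gc w ≡ Gc w' → w ≡ w'
    surj   : ∀ m s → SubDiag m s → ∃ λ w → IsPerm m w × (Gc w ≡ s)

ShuffleCompatible : Code → Set
ShuffleCompatible C = ∀ m γ → IsPerm m γ → ∀ i → i ≤ m →
  ∃ λ t → Code.Gc C (ins i γ) ≡ t ∷ Code.Gc C γ

headOr0 : List ℕ → ℕ
headOr0 []      = 0
headOr0 (t ∷ _) = t

tau : Code → List ℕ → ℕ → ℕ
tau C γ i = headOr0 (Code.Gc C (ins i γ))

Acceptable : Code → Set
Acceptable C = ShuffleCompatible C ×
  (∀ m γ → IsPerm m γ → ∀ k → k ≤ m → ∀ x →
     (∃ λ i → (i ≤ k) × (tau C (ins k γ) i ≡ x)) ⇔ (∃ λ i → (i ≤ k) × (tau C γ i ≡ x)))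

shuffles : List ℕ → List ℕ → List (List ℕ)
shuffles [] ys = ys ∷ []
shuffles (x ∷ xs) [] = (x ∷ xs) ∷ []
shuffles (x ∷ xs) (y ∷ ys) =
  map (x ∷_) (shuffles xs (y ∷ ys)) ++ map (y ∷_) (shuffles (x ∷ xs) ys)

idShuffle : ℕ → List ℕ → List (List ℕ)
idShuffle k β = shuffles (oneTo k) (map (k +_) β)

Sorted : List ℕ → Set
Sorted = Linked _≤_

NondecRearr : List ℕ → List ℕ → Set
NondecRearr s t = Sorted s × (s ↭ t)

ndSeqs : ℕ → ℕ → ℕ → List (List ℕ)
ndSeqs zero    lo n = [] ∷ []
ndSeqs (suc k) lo n =
  concatMap (λ j → map (j ∷_) (ndSeqs k j n)) (map (lo +_) (upTo (suc n ∸ lo)))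

module Poly (R : CommutativeSemiring 0ℓ 0ℓ) where
  open CommutativeSemiring R renaming (_+_ to _⊕_; _*_ to _⊗_)

  sumL : List Carrier → Carrier
  sumL = foldr _⊕_ 0#

  mono : (ℕ → Carrier) → List ℕ → Carrier
  mono x c = foldr _⊗_ 1# (map x c)

  h : ℕ → ℕ → (ℕ → Carrier) → Carrier
  h k n x = sumL (map (mono x) (ndSeqs k 0 n))

-- The words of id_k ⋃ β are exactly σ = 1 ∪_{j_k} (⋯ (1 ∪_{j_1} β)) with n ≥ j_1 ≥ ⋯ ≥ j_k, each
-- obtained once, so compatibility with the shuffle gives Gc(σ) = (t_k, …, t_1) ++ Gc(β), where t_i
-- is the value of τ at position j_i of the word obtained after i - 1 insertions. Acceptability
-- says that inserting at position j does not change the set of values of τ on [0, j]; hence, by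
-- induction on k, the first k letters of Gc(σ) run through all multisets of size k of values of
-- τ_β on [0, n], which is all of [0, n] because τ_β is injective and bounded by n. For the sum,
-- the same induction gives Σ_σ x_{Gc(σ)} = h_k(y_0, …, y_n) x_{Gc(β)} with y_i = x_{τ_β(i)},
-- since h_{k+1}(y_0, …, y_p) = Σ_{j ≤ p} y_j h_k(y_0, …, y_j) and h_k is symmetric; the
-- symmetry both absorbs the reordering of values allowed by acceptability and turns h_k(y) into
-- h_k(X_n).

module Submission where

open import Defs
open import Level using (0ℓ)
open import Data.Nat using (ℕ; zero; suc; _+_; _∸_; _≤_; _≟_; _≤?_; s≤s; s≤s⁻¹)
import Data.Nat.Properties as ℕ
open import Data.Fin using (Fin; toℕ; fromℕ<; punchOut)
import Data.Fin.Properties as Fin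
open import Data.List
  using (List; []; _∷_; _++_; [_]; map; take; drop; length; upTo; downFrom; concatMap)
import Data.List.Properties as List
open import Data.List.Membership.Propositional using (_∈_; _∉_; find; lose)
open import Data.List.Membership.Propositional.Properties
  using (∈-map⁺; ∈-map⁻; ∈-concatMap⁺; ∈-concatMap⁻; ∈-downFrom⁺; ∈-downFrom⁻; ∈-upTo⁺; ∈-upTo⁻)
open import Data.List.Membership.Propositional.Properties.WithK using (unique∧set⇒bag)
open import Data.List.Relation.Binary.BagAndSetEquality using (∼bag⇒↭)
open import Data.List.Relation.Binary.Permutation.Propositional
  using (_↭_; refl; prep; swap; trans; ↭-sym; ↭-reflexive; module PermutationReasoning)
import Data.List.Relation.Binary.Permutation.Propositional.Properties as ↭
open import Data.List.Relation.Unary.All using (All; []; _∷_)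
import Data.List.Relation.Unary.All as All
import Data.List.Relation.Unary.All.Properties as All
open import Data.List.Relation.Unary.Any using (here; there)
open import Data.List.Relation.Unary.AllPairs using ([]; _∷_)
open import Data.List.Relation.Unary.Unique.Propositional using (Unique)
open import Data.List.Relation.Unary.Unique.Propositional.Properties using (upTo⁺; downFrom⁺)
open import Data.Product using (∃; _×_; _,_; proj₁; proj₂)
open import Data.Empty using (⊥-elim)
open import Relation.Nullary using (yes; no)
open import Function using (_∘_; id)
open import Function.Bundles using (_⇔_; mk⇔; Equivalence)
open import Function.Properties.Equivalence using () renaming (trans to ⇔-trans; sym to ⇔-sym)
open import Relation.Binary.PropositionalEquality
  using (_≡_; _≢_; refl; sym; cong; cong₂; subst; module ≡-Reasoning)
  renaming (trans to ≡-trans)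
open import Algebra.Bundles using (CommutativeSemiring)

upTo-suc : ∀ n → upTo (suc n) ≡ 0 ∷ map suc (upTo n)
upTo-suc n = cong (0 ∷_) (sym (List.map-applyUpTo id suc n))

map-+-upTo-suc : ∀ lo c → map (lo +_) (upTo (suc c)) ≡ lo ∷ map (suc lo +_) (upTo c)
map-+-upTo-suc lo c = ≡-trans (cong (map (lo +_)) (upTo-suc c)) (cong₂ _∷_ (ℕ.+-identityʳ lo)
  (≡-trans (sym (List.map-∘ (upTo c))) (List.map-cong (ℕ.+-suc lo) (upTo c))))

oneTo-suc : ∀ m → oneTo (suc m) ≡ 1 ∷ map suc (oneTo m)
oneTo-suc m = cong (map suc) (upTo-suc m)

oneTo-∷ʳ : ∀ k → oneTo (suc k) ≡ oneTo k ++ [ suc k ]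
oneTo-∷ʳ k = ≡-trans (cong (map suc) (sym (List.upTo-∷ʳ k))) (List.map-++ suc (upTo k) [ k ])

length-oneTo : ∀ m → length (oneTo m) ≡ m
length-oneTo m = ≡-trans (List.length-map suc (upTo m)) (List.length-upTo m)

IsPerm⇒length : ∀ {m γ} → IsPerm m γ → length γ ≡ m
IsPerm⇒length {m} γ↭ = ≡-trans (↭.↭-length γ↭) (length-oneTo m)

IsPerm⇒0∉ : ∀ {m γ} → IsPerm m γ → 0 ∉ γ
IsPerm⇒0∉ γ↭ 0∈γ with ∈-map⁻ suc (↭.∈-resp-↭ γ↭ 0∈γ)
... | _ , _ , ()

ins-↭ : ∀ i γ → ins i γ ↭ 1 ∷ map suc γ
ins-↭ i γ = trans (↭.shift 1 (take i (map suc γ)) (drop i (map suc γ)))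
                  (prep 1 (↭-reflexive (List.take++drop≡id i (map suc γ))))

length-ins : ∀ i γ → length (ins i γ) ≡ suc (length γ)
length-ins i γ = ≡-trans (↭.↭-length (ins-↭ i γ)) (cong suc (List.length-map suc γ))

IsPerm-ins : ∀ {m γ} i → IsPerm m γ → IsPerm (suc m) (ins i γ)
IsPerm-ins {m} {γ} i γ↭ =
  trans (ins-↭ i γ) (trans (prep 1 (↭.map⁺ suc γ↭)) (↭-reflexive (sym (oneTo-suc m))))

ins-injective : ∀ {γ i j} → 0 ∉ γ → i ≤ length γ → j ≤ length γ → ins i γ ≡ ins j γ → i ≡ j
ins-injective {_}     {zero}  {zero}  _  _       _       _  = refl
ins-injective {g ∷ _} {zero}  {suc _} 0∉ _       _       eq =
  ⊥-elim (0∉ (here (ℕ.suc-injective (List.∷-injectiveˡ eq))))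
ins-injective {g ∷ _} {suc _} {zero}  0∉ _       _       eq =
  ⊥-elim (0∉ (here (ℕ.suc-injective (sym (List.∷-injectiveˡ eq)))))
ins-injective {g ∷ _} {suc _} {suc _} 0∉ (s≤s i≤) (s≤s j≤) eq =
  cong suc (ins-injective (0∉ ∘ there) i≤ j≤ (List.∷-injectiveʳ eq))

module _ {A : Set} where

  take-++-length : ∀ {j} (xs ys : List A) → length xs ≡ j → take j (xs ++ ys) ≡ xs
  take-++-length []       ys refl = refl
  take-++-length (x ∷ xs) ys refl = cong (x ∷_) (take-++-length xs ys refl)

  drop-++-length : ∀ {j} (xs ys : List A) → length xs ≡ j → drop j (xs ++ ys) ≡ ys
  drop-++-length []       ys refl = refl
  drop-++-length (x ∷ xs) ys refl = drop-++-length xs ys refl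

  length-take-≤ : ∀ j (ys : List A) → j ≤ length ys → length (take j ys) ≡ j
  length-take-≤ j ys j≤ = ≡-trans (List.length-take j ys) (ℕ.m≤n⇒m⊓n≡m j≤)

  take-take-≤ : ∀ {j p} (ys : List A) → j ≤ p → take j (take p ys) ≡ take j ys
  take-take-≤ {j} {p} ys j≤p = ≡-trans (List.take-take j p ys) (cong (λ q → take q ys) (ℕ.m≤n⇒m⊓n≡m j≤p))

  drop-take-++-drop : ∀ {j p} (ys : List A) → j ≤ p → drop j (take p ys) ++ drop p ys ≡ drop j ys
  drop-take-++-drop {zero}  {p}     ys       _         = List.take++drop≡id p ys
  drop-take-++-drop {suc _} {suc _} []       _         = refl
  drop-take-++-drop {suc _} {suc _} (y ∷ ys) (s≤s j≤p) = drop-take-++-drop ys j≤p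

  ++-swapʳ : ∀ (P Q R : List A) → (P ++ Q) ++ R ↭ (P ++ R) ++ Q
  ++-swapʳ P Q R = trans (↭-reflexive (List.++-assoc P Q R))
    (trans (↭.++⁺ˡ P (↭.++-comm Q R)) (↭-reflexive (sym (List.++-assoc P R Q))))

  unique-↭ : ∀ {xs ys : List A} → Unique xs → Unique ys → (∀ {v} → v ∈ xs ⇔ v ∈ ys) → xs ↭ ys
  unique-↭ xs! ys! xs≈ys = ∼bag⇒↭ (unique∧set⇒bag xs! ys! xs≈ys)

module _ {A B : Set} where

  ∈-concatMap-∃ : ∀ {F : A → List B} {xs w} → w ∈ concatMap F xs → ∃ λ j → j ∈ xs × w ∈ F j
  ∈-concatMap-∃ {F} = find ∘ ∈-concatMap⁻ F

  concatMap-↭-∈ : ∀ {F G : A → List B} xs → (∀ {j} → j ∈ xs → F j ↭ G j) →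
                  concatMap F xs ↭ concatMap G xs
  concatMap-↭-∈ []       F↭G = refl
  concatMap-↭-∈ (x ∷ xs) F↭G = ↭.++⁺ (F↭G (here refl)) (concatMap-↭-∈ xs (F↭G ∘ there))

  concatMap-++-↭ : ∀ (F G : A → List B) xs →
                   concatMap (λ j → F j ++ G j) xs ↭ concatMap F xs ++ concatMap G xs
  concatMap-++-↭ F G []       = refl
  concatMap-++-↭ F G (x ∷ xs) = begin
    (F x ++ G x) ++ concatMap (λ j → F j ++ G j) xs  ≡⟨ List.++-assoc (F x) (G x) _ ⟩
    F x ++ G x ++ concatMap (λ j → F j ++ G j) xs    ↭⟨ ↭.++⁺ˡ (F x) (↭.++⁺ˡ (G x) (concatMap-++-↭ F G xs)) ⟩
    F x ++ G x ++ concatMap F xs ++ concatMap G xs   ↭⟨ ↭.++⁺ˡ (F x) (↭.shifts (G x) (concatMap F xs)) ⟩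
    F x ++ concatMap F xs ++ G x ++ concatMap G xs   ≡⟨ List.++-assoc (F x) (concatMap F xs) _ ⟨
    (F x ++ concatMap F xs) ++ G x ++ concatMap G xs ∎
    where open PermutationReasoning

  unique-map⁺-∈ : ∀ {f : A → B} {xs} → (∀ {x y} → x ∈ xs → y ∈ xs → f x ≡ f y → x ≡ y) →
                  Unique xs → Unique (map f xs)
  unique-map⁺-∈ f-inj []           = []
  unique-map⁺-∈ f-inj (x∉ ∷ xs!) =
    All.map⁺ (All.tabulate (λ y∈ fx≡fy → All.lookup x∉ y∈ (f-inj (here refl) (there y∈) fx≡fy)))
    ∷ unique-map⁺-∈ (λ x∈ y∈ → f-inj (there x∈) (there y∈)) xs!

concatMap-downFrom-suc : ∀ {B : Set} (F : ℕ → List B) N →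
  concatMap F (downFrom (suc N)) ≡ concatMap (F ∘ suc) (downFrom N) ++ F 0
concatMap-downFrom-suc F zero    = List.++-identityʳ (F 0)
concatMap-downFrom-suc F (suc N) =
  ≡-trans (cong (F (suc N) ++_) (concatMap-downFrom-suc F N)) (sym (List.++-assoc (F (suc N)) _ (F 0)))

shuffles-[] : ∀ xs → shuffles xs [] ≡ [ xs ]
shuffles-[] []      = refl
shuffles-[] (_ ∷ _) = refl

interleaveAt : List ℕ → ℕ → List ℕ → ℕ → List (List ℕ)
interleaveAt xs x Z j = map (_++ x ∷ drop j Z) (shuffles xs (take j Z))

splitShuffles : List ℕ → ℕ → List ℕ → List (List ℕ)
splitShuffles xs x Z = concatMap (interleaveAt xs x Z) (downFrom (suc (length Z)))

map-++-∷ : ∀ (a : ℕ) r (S : List (List ℕ)) → map (_++ r) (map (a ∷_) S) ≡ map (a ∷_) (map (_++ r) S)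
map-++-∷ a r S = ≡-trans (sym (List.map-∘ S)) (List.map-∘ S)

interleaveAt-∷-suc : ∀ a xs x y Z j → interleaveAt (a ∷ xs) x (y ∷ Z) (suc j) ≡
  map (a ∷_) (interleaveAt xs x (y ∷ Z) (suc j)) ++ map (y ∷_) (interleaveAt (a ∷ xs) x Z j)
interleaveAt-∷-suc a xs x y Z j =
  ≡-trans (List.map-++ (_++ x ∷ drop j Z) (map (a ∷_) (shuffles xs (y ∷ take j Z))) _)
          (cong₂ _++_ (map-++-∷ a (x ∷ drop j Z) (shuffles xs (y ∷ take j Z)))
                       (map-++-∷ y (x ∷ drop j Z) (shuffles (a ∷ xs) (take j Z))))

interleaveAt-∷-zero : ∀ a xs x Z → interleaveAt (a ∷ xs) x Z 0 ≡ map (a ∷_) (interleaveAt xs x Z 0)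
interleaveAt-∷-zero a xs x Z = cong (map (a ∷_) ∘ map (_++ x ∷ Z)) (sym (shuffles-[] xs))

splitShuffles-[]-∷ : ∀ x y Z → splitShuffles [] x (y ∷ Z) ≡ map (y ∷_) (splitShuffles [] x Z) ++ [ x ∷ y ∷ Z ]
splitShuffles-[]-∷ x y Z = ≡-trans (concatMap-downFrom-suc (interleaveAt [] x (y ∷ Z)) (suc (length Z)))
  (cong (_++ [ x ∷ y ∷ Z ]) (sym (List.map-concatMap (y ∷_) (interleaveAt [] x Z) (downFrom (suc (length Z))))))

splitShuffles-∷-∷ : ∀ a xs x y Z → splitShuffles (a ∷ xs) x (y ∷ Z) ↭
  map (a ∷_) (splitShuffles xs x (y ∷ Z)) ++ map (y ∷_) (splitShuffles (a ∷ xs) x Z)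
splitShuffles-∷-∷ a xs x y Z = begin
  splitShuffles (a ∷ xs) x (y ∷ Z)
    ≡⟨ concatMap-downFrom-suc (interleaveAt (a ∷ xs) x (y ∷ Z)) (suc (length Z)) ⟩
  concatMap (interleaveAt (a ∷ xs) x (y ∷ Z) ∘ suc) ds ++ interleaveAt (a ∷ xs) x (y ∷ Z) 0
    ≡⟨ cong₂ _++_ (List.concatMap-cong (interleaveAt-∷-suc a xs x y Z) ds) (interleaveAt-∷-zero a xs x (y ∷ Z)) ⟩
  concatMap (λ j → map (a ∷_) (I (suc j)) ++ map (y ∷_) (K j)) ds ++ map (a ∷_) (I 0)
    ↭⟨ ↭.++⁺ʳ _ (concatMap-++-↭ (map (a ∷_) ∘ I ∘ suc) (map (y ∷_) ∘ K) ds) ⟩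
  (concatMap (map (a ∷_) ∘ I ∘ suc) ds ++ concatMap (map (y ∷_) ∘ K) ds) ++ map (a ∷_) (I 0)
    ↭⟨ ++-swapʳ (concatMap (map (a ∷_) ∘ I ∘ suc) ds) _ _ ⟩
  (concatMap (map (a ∷_) ∘ I ∘ suc) ds ++ map (a ∷_) (I 0)) ++ concatMap (map (y ∷_) ∘ K) ds
    ≡⟨ cong₂ _++_ firstLetterA (sym (List.map-concatMap (y ∷_) K ds)) ⟩
  map (a ∷_) (splitShuffles xs x (y ∷ Z)) ++ map (y ∷_) (splitShuffles (a ∷ xs) x Z) ∎
  where
  open PermutationReasoning
  ds = downFrom (suc (length Z))
  I = interleaveAt xs x (y ∷ Z)
  K = interleaveAt (a ∷ xs) x Z
  firstLetterA : concatMap (map (a ∷_) ∘ I ∘ suc) ds ++ map (a ∷_) (I 0) ≡ map (a ∷_) (splitShuffles xs x (y ∷ Z))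
  firstLetterA = ≡-trans (cong (_++ map (a ∷_) (I 0)) (sym (List.map-concatMap (a ∷_) (I ∘ suc) ds)))
    (≡-trans (sym (List.map-++ (a ∷_) (concatMap (I ∘ suc) ds) (I 0)))
             (cong (map (a ∷_)) (sym (concatMap-downFrom-suc I (suc (length Z))))))

shuffles-∷ʳ : ∀ xs x Z → shuffles (xs ++ [ x ]) Z ↭ splitShuffles xs x Z
shuffles-∷ʳ xs x [] =
  ↭-reflexive (≡-trans (shuffles-[] (xs ++ [ x ])) (cong (λ S → map (_++ [ x ]) S ++ []) (sym (shuffles-[] xs))))
shuffles-∷ʳ [] x (y ∷ Z) =
  trans (↭.++⁺ˡ [ x ∷ y ∷ Z ] (↭.map⁺ (y ∷_) (shuffles-∷ʳ [] x Z)))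
        (trans (↭.++-comm [ x ∷ y ∷ Z ] _) (↭-reflexive (sym (splitShuffles-[]-∷ x y Z))))
shuffles-∷ʳ (a ∷ xs) x (y ∷ Z) =
  trans (↭.++⁺ (↭.map⁺ (a ∷_) (shuffles-∷ʳ xs x (y ∷ Z))) (↭.map⁺ (y ∷_) (shuffles-∷ʳ (a ∷ xs) x Z)))
        (↭-sym (splitShuffles-∷-∷ a xs x y Z))

-- insertions k γ p lists the words 1 ∪_{j_k} (⋯ (1 ∪_{j_1} γ)) with p ≥ j_1 ≥ ⋯ ≥ j_k.
insertions : ℕ → List ℕ → ℕ → List (List ℕ)
insertions zero    γ p = [ γ ]
insertions (suc k) γ p = concatMap (λ j → insertions k (ins j γ) j) (downFrom (suc p))

map-+-ins : ∀ k j γ →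
  map (k +_) (ins j γ) ≡ take j (map (suc k +_) γ) ++ suc k ∷ drop j (map (suc k +_) γ)
map-+-ins k j γ = begin
  map (k +_) (take j (map suc γ) ++ 1 ∷ drop j (map suc γ))
    ≡⟨ List.map-++ (k +_) (take j (map suc γ)) _ ⟩
  map (k +_) (take j (map suc γ)) ++ k + 1 ∷ map (k +_) (drop j (map suc γ))
    ≡⟨ cong₂ (λ U V → U ++ k + 1 ∷ V) (List.take-map j (map suc γ)) (List.drop-map j (map suc γ)) ⟨
  take j (map (k +_) (map suc γ)) ++ k + 1 ∷ drop j (map (k +_) (map suc γ))
    ≡⟨ cong₂ (λ U c → take j U ++ c ∷ drop j U) k+suc (ℕ.+-comm k 1) ⟩
  take j (map (suc k +_) γ) ++ suc k ∷ drop j (map (suc k +_) γ) ∎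
  where
  open ≡-Reasoning
  k+suc : map (k +_) (map suc γ) ≡ map (suc k +_) γ
  k+suc = ≡-trans (sym (List.map-∘ γ)) (List.map-cong (ℕ.+-suc k) γ)

interleaveAt-take : ∀ xs x Y {j p} → j ≤ p →
  map (_++ drop p Y) (interleaveAt xs x (take p Y) j) ≡ interleaveAt xs x Y j
interleaveAt-take xs x Y {j} {p} j≤p = begin
  map (_++ drop p Y) (map (_++ x ∷ drop j (take p Y)) (shuffles xs (take j (take p Y))))
    ≡⟨ List.map-∘ _ ⟨
  map (λ s → (s ++ x ∷ drop j (take p Y)) ++ drop p Y) (shuffles xs (take j (take p Y)))
    ≡⟨ List.map-cong (λ s → ≡-trans (List.++-assoc s _ _) (cong (λ R → s ++ x ∷ R) (drop-take-++-drop Y j≤p))) _ ⟩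
  map (_++ x ∷ drop j Y) (shuffles xs (take j (take p Y)))
    ≡⟨ cong (map (_++ x ∷ drop j Y) ∘ shuffles xs) (take-take-≤ Y j≤p) ⟩
  map (_++ x ∷ drop j Y) (shuffles xs (take j Y)) ∎
  where open ≡-Reasoning

insertions-↭ : ∀ k γ p → p ≤ length γ →
  insertions k γ p ↭ map (_++ drop p (map (k +_) γ)) (shuffles (oneTo k) (take p (map (k +_) γ)))
insertions-↭ zero γ p _ =
  ↭-reflexive (cong [_] (sym (≡-trans (List.take++drop≡id p (map (0 +_) γ)) (List.map-id γ))))
insertions-↭ (suc k) γ p p≤ = begin
  concatMap (λ j → insertions k (ins j γ) j) ds
    ↭⟨ concatMap-↭-∈ ds (λ j∈ → trans (insertions-↭ k (ins _ γ) _ (j≤ins j∈)) (↭-reflexive (step j∈))) ⟩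
  concatMap (map (_++ D) ∘ interleaveAt (oneTo k) (suc k) Z) ds
    ≡⟨ List.map-concatMap (_++ D) (interleaveAt (oneTo k) (suc k) Z) ds ⟨
  map (_++ D) (concatMap (interleaveAt (oneTo k) (suc k) Z) ds)
    ≡⟨ cong (λ q → map (_++ D) (concatMap (interleaveAt (oneTo k) (suc k) Z) (downFrom (suc q))))
            (sym (length-take-≤ p Y (Y-long ℕ.≤-refl))) ⟩
  map (_++ D) (splitShuffles (oneTo k) (suc k) Z)
    ↭⟨ ↭.map⁺ (_++ D) (↭-sym (shuffles-∷ʳ (oneTo k) (suc k) Z)) ⟩
  map (_++ D) (shuffles (oneTo k ++ [ suc k ]) Z)
    ≡⟨ cong (λ o → map (_++ D) (shuffles o Z)) (oneTo-∷ʳ k) ⟨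
  map (_++ D) (shuffles (oneTo (suc k)) Z) ∎
  where
  open PermutationReasoning
  ds = downFrom (suc p)
  Y = map (suc k +_) γ
  Z = take p Y
  D = drop p Y
  Y-long : ∀ {j} → j ≤ p → j ≤ length Y
  Y-long j≤ = ℕ.≤-trans j≤ (ℕ.≤-trans p≤ (ℕ.≤-reflexive (sym (List.length-map (suc k +_) γ))))
  j≤p : ∀ {j} → j ∈ ds → j ≤ p
  j≤p = s≤s⁻¹ ∘ ∈-downFrom⁻
  j≤ins : ∀ {j} → j ∈ ds → j ≤ length (ins j γ)
  j≤ins {j} j∈ = ℕ.≤-trans (ℕ.≤-trans (j≤p j∈) p≤) (ℕ.≤-trans (ℕ.n≤1+n _) (ℕ.≤-reflexive (sym (length-ins j γ))))
  step : ∀ {j} → j ∈ ds →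
    map (_++ drop j (map (k +_) (ins j γ))) (shuffles (oneTo k) (take j (map (k +_) (ins j γ))))
      ≡ map (_++ D) (interleaveAt (oneTo k) (suc k) Z j)
  step {j} j∈ rewrite map-+-ins k j γ = ≡-trans (cong₂ (λ R S → map (_++ R) (shuffles (oneTo k) S))
          (drop-++-length (take j Y) _ (length-take-≤ j Y (Y-long (j≤p j∈))))
          (take-++-length (take j Y) _ (length-take-≤ j Y (Y-long (j≤p j∈)))))
      (sym (interleaveAt-take (oneTo k) (suc k) Y (j≤p j∈)))

idShuffle-↭-insertions : ∀ k n β → length β ≡ n → idShuffle k β ↭ insertions k β n
idShuffle-↭-insertions k n β refl = ↭-sym (trans (insertions-↭ k β (length β) ℕ.≤-refl) (↭-reflexive whole))
  where
  Y = map (k +_) β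
  Y≤ : length Y ≤ length β
  Y≤ = ℕ.≤-reflexive (List.length-map (k +_) β)
  whole : map (_++ drop (length β) Y) (shuffles (oneTo k) (take (length β) Y)) ≡ shuffles (oneTo k) Y
  whole = ≡-trans (cong₂ (λ R S → map (_++ R) (shuffles (oneTo k) S)) (List.drop-all _ Y Y≤) (List.take-all _ Y Y≤))
                  (≡-trans (List.map-cong List.++-identityʳ _) (List.map-id _))

module CompleteHomogeneous (R : CommutativeSemiring 0ℓ 0ℓ) where
  open CommutativeSemiring R
    renaming (_+_ to _⊕_; _*_ to _⊗_; refl to ≈-refl; reflexive to ≈-reflexive; sym to ≈-sym; trans to ≈-trans)
  open Poly R using (sumL; mono; h)
  open import Relation.Binary.Reasoning.Setoid setoid
  open import Algebra.Solver.Ring.NaturalCoefficients.Default R using (solve; _:+_; _:*_; _:=_)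
  open import Data.List.Relation.Binary.Permutation.Setoid.Properties setoid using (foldr-commMonoid)
  open import Data.List.Relation.Binary.Permutation.Propositional using (↭⇒↭ₛ′)

  -- complete k vs is h_k evaluated at the entries of vs, split by whether the first entry occurs.
  complete : ℕ → List Carrier → Carrier
  complete zero    _        = 1#
  complete (suc k) []       = 0#
  complete (suc k) (v ∷ vs) = complete (suc k) vs ⊕ v ⊗ complete k (v ∷ vs)

  complete-swap : ∀ k a b vs → complete k (a ∷ b ∷ vs) ≈ complete k (b ∷ a ∷ vs)
  complete-swap zero          a b vs = ≈-refl
  complete-swap (suc zero)    a b vs =
    solve 4 (λ e a b u → (e :+ b :* u) :+ a :* u := (e :+ a :* u) :+ b :* u) ≈-refl (complete 1 vs) a b 1#
  complete-swap (suc (suc k)) a b vs = begin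
    (e ⊕ b ⊗ eb) ⊕ a ⊗ complete (suc k) (a ∷ b ∷ vs) ≈⟨ +-congˡ (*-congˡ (complete-swap (suc k) a b vs)) ⟩
    (e ⊕ b ⊗ eb) ⊕ a ⊗ (ea ⊕ b ⊗ g)                  ≈⟨ exchange e a b ea eb g ⟩
    (e ⊕ a ⊗ ea) ⊕ b ⊗ (eb ⊕ a ⊗ g)                  ≈⟨ +-congˡ (*-congˡ (+-congˡ (*-congˡ (complete-swap k b a vs)))) ⟩
    (e ⊕ a ⊗ ea) ⊕ b ⊗ complete (suc k) (a ∷ b ∷ vs) ≈⟨ +-congˡ (*-congˡ (complete-swap (suc k) a b vs)) ⟩
    (e ⊕ a ⊗ ea) ⊕ b ⊗ complete (suc k) (b ∷ a ∷ vs) ∎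
    where
    e  = complete (suc (suc k)) vs
    ea = complete (suc k) (a ∷ vs)
    eb = complete (suc k) (b ∷ vs)
    g  = complete k (b ∷ a ∷ vs)
    exchange : ∀ e a b ea eb g → (e ⊕ b ⊗ eb) ⊕ a ⊗ (ea ⊕ b ⊗ g) ≈ (e ⊕ a ⊗ ea) ⊕ b ⊗ (eb ⊕ a ⊗ g)
    exchange = solve 6 (λ e a b ea eb g →
      (e :+ b :* eb) :+ a :* (ea :+ b :* g) := (e :+ a :* ea) :+ b :* (eb :+ a :* g)) ≈-refl

  complete-∷ : ∀ {vs ws} v → (∀ k → complete k vs ≈ complete k ws) → ∀ k → complete k (v ∷ vs) ≈ complete k (v ∷ ws)
  complete-∷ v vs≈ws zero    = ≈-refl
  complete-∷ v vs≈ws (suc k) = +-cong (vs≈ws (suc k)) (*-congˡ (complete-∷ v vs≈ws k))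

  complete-↭ : ∀ {vs ws} → vs ↭ ws → ∀ k → complete k vs ≈ complete k ws
  complete-↭ refl         k = ≈-refl
  complete-↭ (prep v p)     = complete-∷ v (complete-↭ p)
  complete-↭ (swap a b p) k = ≈-trans (complete-swap k a b _) (complete-∷ b (complete-∷ a (complete-↭ p)) k)
  complete-↭ (trans p q)  k = ≈-trans (complete-↭ p k) (complete-↭ q k)

  sumL-↭ : ∀ {xs ys} → xs ↭ ys → sumL xs ≈ sumL ys
  sumL-↭ p = foldr-commMonoid +-isCommutativeMonoid (↭⇒↭ₛ′ isEquivalence p)

  sumL-++ : ∀ xs ys → sumL (xs ++ ys) ≈ sumL xs ⊕ sumL ys
  sumL-++ []       ys = ≈-sym (+-identityˡ _)
  sumL-++ (x ∷ xs) ys = ≈-trans (+-congˡ (sumL-++ xs ys)) (≈-sym (+-assoc x _ _))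

  sumL-concatMap : ∀ {A B : Set} (f : B → Carrier) (F : A → List B) js →
                   sumL (map f (concatMap F js)) ≈ sumL (map (λ j → sumL (map f (F j))) js)
  sumL-concatMap f F []       = ≈-refl
  sumL-concatMap f F (j ∷ js) = begin
    sumL (map f (F j ++ concatMap F js))                 ≡⟨ cong sumL (List.map-++ f (F j) (concatMap F js)) ⟩
    sumL (map f (F j) ++ map f (concatMap F js))         ≈⟨ sumL-++ (map f (F j)) _ ⟩
    sumL (map f (F j)) ⊕ sumL (map f (concatMap F js))  ≈⟨ +-congˡ (sumL-concatMap f F js) ⟩
    sumL (map (λ j → sumL (map f (F j))) (j ∷ js))      ∎

  sumL-cong-∈ : ∀ {A : Set} {f g : A → Carrier} xs → (∀ {a} → a ∈ xs → f a ≈ g a) →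
                sumL (map f xs) ≈ sumL (map g xs)
  sumL-cong-∈ []       f≈g = ≈-refl
  sumL-cong-∈ (a ∷ xs) f≈g = +-cong (f≈g (here refl)) (sumL-cong-∈ xs (f≈g ∘ there))

  sumL-*ˡ : ∀ {A : Set} c (f : A → Carrier) xs → sumL (map (λ a → c ⊗ f a) xs) ≈ c ⊗ sumL (map f xs)
  sumL-*ˡ c f []       = ≈-sym (zeroʳ c)
  sumL-*ˡ c f (a ∷ xs) = ≈-trans (+-congˡ (sumL-*ˡ c f xs)) (≈-sym (distribˡ c _ _))

  sumL-*ʳ : ∀ {A : Set} (f : A → Carrier) c xs → sumL (map (λ a → f a ⊗ c) xs) ≈ sumL (map f xs) ⊗ c
  sumL-*ʳ f c []       = ≈-sym (zeroˡ c)
  sumL-*ʳ f c (a ∷ xs) = ≈-trans (+-congˡ (sumL-*ʳ f c xs)) (≈-sym (distribʳ c _ _))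

  complete-downFrom : ∀ (g : ℕ → Carrier) k N → complete (suc k) (map g (downFrom N)) ≈
    sumL (map (λ j → g j ⊗ complete k (map g (downFrom (suc j)))) (downFrom N))
  complete-downFrom g k zero    = ≈-refl
  complete-downFrom g k (suc N) = ≈-trans (+-comm _ _) (+-congˡ (complete-downFrom g k N))

  module _ (x : ℕ → Carrier) (n : ℕ) where

    hFrom : ℕ → ℕ → Carrier
    hFrom k lo = sumL (map (mono x) (ndSeqs k lo n))

    hFrom≈complete : ∀ k lo c → lo + c ≡ suc n → hFrom k lo ≈ complete k (map x (map (lo +_) (upTo c)))
    hFrom≈complete zero    lo c _    = +-identityʳ 1#
    hFrom≈complete (suc k) lo c lo+c = begin
      sumL (map (mono x) (concatMap (λ j → map (j ∷_) (ndSeqs k j n)) js))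
        ≈⟨ sumL-concatMap (mono x) (λ j → map (j ∷_) (ndSeqs k j n)) js ⟩
      sumL (map (λ j → sumL (map (mono x) (map (j ∷_) (ndSeqs k j n)))) js)
        ≈⟨ sumL-cong-∈ js (λ {j} _ → ≈-trans (≈-reflexive (cong sumL (sym (List.map-∘ (ndSeqs k j n)))))
                                                (sumL-*ˡ (x j) (mono x) (ndSeqs k j n))) ⟩
      sumL (map F js)
        ≡⟨ cong (λ c′ → sumL (map F (map (lo +_) (upTo c′)))) (≡-trans (cong (_∸ lo) (sym lo+c)) (ℕ.m+n∸m≡n lo c)) ⟩
      sumL (map F (map (lo +_) (upTo c)))
        ≈⟨ byFirstLetter c lo lo+c ⟩
      complete (suc k) (map x (map (lo +_) (upTo c))) ∎
      where
      js = map (lo +_) (upTo (suc n ∸ lo))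
      F : ℕ → Carrier
      F j = x j ⊗ hFrom k j
      byFirstLetter : ∀ c lo → lo + c ≡ suc n →
        sumL (map F (map (lo +_) (upTo c))) ≈ complete (suc k) (map x (map (lo +_) (upTo c)))
      byFirstLetter zero    lo _    = ≈-refl
      byFirstLetter (suc c) lo lo+c = begin
        sumL (map F (map (lo +_) (upTo (suc c))))
          ≡⟨ cong (sumL ∘ map F) split ⟩
        x lo ⊗ hFrom k lo ⊕ sumL (map F rest)
          ≈⟨ +-cong (*-congˡ (hFrom≈complete k lo (suc c) lo+c)) (byFirstLetter c (suc lo) (≡-trans (sym (ℕ.+-suc lo c)) lo+c)) ⟩
        x lo ⊗ complete k (map x (map (lo +_) (upTo (suc c)))) ⊕ complete (suc k) (map x rest)
          ≡⟨ cong (λ l → x lo ⊗ complete k (map x l) ⊕ complete (suc k) (map x rest)) split ⟩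
        x lo ⊗ complete k (map x (lo ∷ rest)) ⊕ complete (suc k) (map x rest)
          ≈⟨ +-comm _ _ ⟩
        complete (suc k) (map x (lo ∷ rest))
          ≡⟨ cong (complete (suc k) ∘ map x) split ⟨
        complete (suc k) (map x (map (lo +_) (upTo (suc c)))) ∎
        where
        rest = map (suc lo +_) (upTo c)
        split = map-+-upTo-suc lo c

  h≈complete : ∀ x k n → h k n x ≈ complete k (map x (upTo (suc n)))
  h≈complete x k n = ≈-trans (hFrom≈complete x n k 0 (suc n) refl)
                             (≈-reflexive (cong (complete k ∘ map x) (List.map-id (upTo (suc n)))))

ImageUpTo : (ℕ → ℕ) → ℕ → ℕ → Set
ImageUpTo f p t = ∃ λ i → i ≤ p × f i ≡ t

ImageUpTo-mono : ∀ {f p q t} → p ≤ q → ImageUpTo f p t → ImageUpTo f q t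
ImageUpTo-mono p≤q (i , i≤p , fi≡t) = i , ℕ.≤-trans i≤p p≤q , fi≡t

-- A value t missed by f would make f followed by punchOut t an injection Fin (suc n) → Fin n.
injective⇒surjective-≤ : ∀ n (f : ℕ → ℕ) → (∀ {i} → i ≤ n → f i ≤ n) →
  (∀ {i j} → i ≤ n → j ≤ n → f i ≡ f j → i ≡ j) → ∀ {t} → t ≤ n → ImageUpTo f n t
injective⇒surjective-≤ n f f≤ f-inj {t} t≤n with Fin.any? (λ (i : Fin (suc n)) → f (toℕ i) ≟ t)
... | yes (i , fi≡t) = toℕ i , s≤s⁻¹ (Fin.toℕ<n i) , fi≡t
... | no t∉image = ⊥-elim (ℕ.1+n≰n (Fin.injective⇒≤ g-injective))
  where
  i≤n : (i : Fin (suc n)) → toℕ i ≤ n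
  i≤n i = s≤s⁻¹ (Fin.toℕ<n i)
  image : Fin (suc n) → Fin (suc n)
  image i = fromℕ< (s≤s (f≤ (i≤n i)))
  toℕ-image : ∀ i → toℕ (image i) ≡ f (toℕ i)
  toℕ-image i = Fin.toℕ-fromℕ< (s≤s (f≤ (i≤n i)))
  t≢image : ∀ i → fromℕ< (s≤s t≤n) ≢ image i
  t≢image i e = t∉image (i , ≡-trans (sym (toℕ-image i)) (≡-trans (cong toℕ (sym e)) (Fin.toℕ-fromℕ< (s≤s t≤n))))
  g : Fin (suc n) → Fin n
  g i = punchOut (t≢image i)
  g-injective : ∀ {i j} → g i ≡ g j → i ≡ j
  g-injective {i} {j} e = Fin.toℕ-injective (f-inj (i≤n i) (i≤n j)
    (≡-trans (sym (toℕ-image i)) (≡-trans (cong toℕ (Fin.punchOut-injective (t≢image i) (t≢image j) e)) (toℕ-image j))))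

∈-map-downFrom⇔ : ∀ (f : ℕ → ℕ) p {t} → t ∈ map f (downFrom (suc p)) ⇔ ImageUpTo f p t
∈-map-downFrom⇔ f p = mk⇔ to from
  where
  to : ∀ {t} → t ∈ map f (downFrom (suc p)) → ImageUpTo f p t
  to t∈ with i , i∈ , refl ← ∈-map⁻ f t∈ = i , s≤s⁻¹ (∈-downFrom⁻ i∈) , refl
  from : ∀ {t} → ImageUpTo f p t → t ∈ map f (downFrom (suc p))
  from (i , i≤p , refl) = ∈-map⁺ f (∈-downFrom⁺ (s≤s i≤p))

unique-map-downFrom : ∀ (f : ℕ → ℕ) p → (∀ {i j} → i ≤ p → j ≤ p → f i ≡ f j → i ≡ j) →
                      Unique (map f (downFrom (suc p)))
unique-map-downFrom f p f-inj =
  unique-map⁺-∈ (λ i∈ j∈ → f-inj (s≤s⁻¹ (∈-downFrom⁻ i∈)) (s≤s⁻¹ (∈-downFrom⁻ j∈))) (downFrom⁺ (suc p))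

extractMax : ∀ (f : ℕ → ℕ) p v vs → All (ImageUpTo f p) (v ∷ vs) →
  ∃ λ j → j ≤ p × ∃ λ rest → v ∷ vs ↭ f j ∷ rest × All (ImageUpTo f j) rest
extractMax f p v [] ((i , i≤p , refl) ∷ []) = i , i≤p , [] , refl , []
extractMax f p v (v′ ∷ vs) ((i , i≤p , refl) ∷ img) with extractMax f p v′ vs img
... | j , j≤p , rest , v′∷vs↭ , img′ with i ≤? j
...   | yes i≤j = j , j≤p , f i ∷ rest , trans (prep (f i) v′∷vs↭) (swap (f i) (f j) refl) , (i , i≤j , refl) ∷ img′
...   | no  i≰j = i , i≤p , f j ∷ rest , prep (f i) v′∷vs↭ ,
                  (j , j≤i , refl) ∷ All.map (ImageUpTo-mono j≤i) img′
  where j≤i = ℕ.<⇒≤ (ℕ.≰⇒> i≰j)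

module AcceptableCode (C : Code) (acc : Acceptable C) where
  open Code C

  τ : List ℕ → ℕ → ℕ
  τ = tau C

  Gc-ins : ∀ {m γ} → IsPerm m γ → ∀ {i} → i ≤ m → Gc (ins i γ) ≡ τ γ i ∷ Gc γ
  Gc-ins {m} {γ} γ-perm {i} i≤m with _ , eq ← proj₁ acc m γ γ-perm i i≤m =
    ≡-trans eq (cong (_∷ Gc γ) (sym (cong headOr0 eq)))

  τ-≤ : ∀ {m γ} → IsPerm m γ → ∀ {i} → i ≤ m → τ γ i ≤ m
  τ-≤ {m} {γ} γ-perm {i} i≤m with into (suc m) (ins i γ) (IsPerm-ins i γ-perm)
  ... | _ , sd rewrite Gc-ins γ-perm i≤m = subst (τ γ i ≤_) (proj₁ (into m γ γ-perm)) (proj₁ sd)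

  τ-injective : ∀ {m γ} → IsPerm m γ → ∀ {i j} → i ≤ m → j ≤ m → τ γ i ≡ τ γ j → i ≡ j
  τ-injective {m} {γ} γ-perm {i} {j} i≤m j≤m τi≡τj =
    ins-injective (IsPerm⇒0∉ γ-perm) (≤length i≤m) (≤length j≤m)
      (inj (suc m) _ _ (IsPerm-ins i γ-perm) (IsPerm-ins j γ-perm)
           (≡-trans (Gc-ins γ-perm i≤m) (≡-trans (cong (_∷ Gc γ) τi≡τj) (sym (Gc-ins γ-perm j≤m)))))
    where
    ≤length : ∀ {i} → i ≤ m → i ≤ length γ
    ≤length i≤m = subst (_ ≤_) (sym (IsPerm⇒length γ-perm)) i≤m

  τ-surjective : ∀ {m γ} → IsPerm m γ → ∀ {t} → t ≤ m → ImageUpTo (τ γ) m t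
  τ-surjective {m} {γ} γ-perm = injective⇒surjective-≤ m (τ γ) (τ-≤ γ-perm) (τ-injective γ-perm)

  τ-bijective : ∀ {n β} → IsPerm n β → map (τ β) (downFrom (suc n)) ↭ upTo (suc n)
  τ-bijective {n} {β} β-perm =
    unique-↭ (unique-map-downFrom (τ β) n (τ-injective β-perm)) (upTo⁺ (suc n)) (mk⇔ to from)
    where
    to : ∀ {t} → t ∈ map (τ β) (downFrom (suc n)) → t ∈ upTo (suc n)
    to t∈ with i , i≤n , refl ← Equivalence.to (∈-map-downFrom⇔ (τ β) n) t∈ =
      ∈-upTo⁺ (s≤s (τ-≤ β-perm i≤n))
    from : ∀ {t} → t ∈ upTo (suc n) → t ∈ map (τ β) (downFrom (suc n))
    from t∈ = Equivalence.from (∈-map-downFrom⇔ (τ β) n) (τ-surjective β-perm (s≤s⁻¹ (∈-upTo⁻ t∈)))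

  image-ins : ∀ {m γ} → IsPerm m γ → ∀ {j} → j ≤ m → ∀ {t} →
              ImageUpTo (τ (ins j γ)) j t ⇔ ImageUpTo (τ γ) j t
  image-ins {m} {γ} γ-perm {j} j≤m = proj₂ acc m γ γ-perm j j≤m _

  τ-ins-↭ : ∀ {m γ} → IsPerm m γ → ∀ {j} → j ≤ m →
            map (τ (ins j γ)) (downFrom (suc j)) ↭ map (τ γ) (downFrom (suc j))
  τ-ins-↭ {m} {γ} γ-perm {j} j≤m =
    unique-↭ (unique-map-downFrom (τ (ins j γ)) j (λ a b → τ-injective (IsPerm-ins j γ-perm) (≤suc a) (≤suc b)))
             (unique-map-downFrom (τ γ) j (λ a b → τ-injective γ-perm (ℕ.≤-trans a j≤m) (ℕ.≤-trans b j≤m)))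
             (⇔-trans (∈-map-downFrom⇔ (τ (ins j γ)) j)
               (⇔-trans (image-ins γ-perm j≤m) (⇔-sym (∈-map-downFrom⇔ (τ γ) j))))
    where
    ≤suc : ∀ {i} → i ≤ j → i ≤ suc m
    ≤suc i≤j = ℕ.≤-trans i≤j (ℕ.≤-trans j≤m (ℕ.n≤1+n m))

  ++-Gc-ins : ∀ {m γ} → IsPerm m γ → ∀ {j} → j ≤ m → ∀ ts → ts ++ Gc (ins j γ) ≡ (ts ++ [ τ γ j ]) ++ Gc γ
  ++-Gc-ins {γ = γ} γ-perm {j} j≤m ts =
    ≡-trans (cong (ts ++_) (Gc-ins γ-perm j≤m)) (sym (List.++-assoc ts [ τ γ j ] (Gc γ)))

  insertions-Gc⁻ : ∀ k {m γ} p → IsPerm m γ → p ≤ m → ∀ {w} → w ∈ insertions k γ p →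
    ∃ λ ts → Gc w ≡ ts ++ Gc γ × length ts ≡ k × All (ImageUpTo (τ γ) p) ts
  insertions-Gc⁻ zero    p γ-perm p≤m (here refl) = [] , refl , refl , []
  insertions-Gc⁻ (suc k) {m} {γ} p γ-perm p≤m w∈ =
    let j , j∈ , w∈′ = ∈-concatMap-∃ w∈
        j≤p = s≤s⁻¹ (∈-downFrom⁻ j∈)
        j≤m = ℕ.≤-trans j≤p p≤m
        ts , Gc-w , ∣ts∣ , img = insertions-Gc⁻ k j (IsPerm-ins j γ-perm) (ℕ.m≤n⇒m≤1+n j≤m) w∈′
    in ts ++ [ τ γ j ] ,
       ≡-trans Gc-w (++-Gc-ins γ-perm j≤m ts) ,
       ≡-trans (List.length-++ ts) (≡-trans (cong (_+ 1) ∣ts∣) (ℕ.+-comm k 1)) ,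
       All.++⁺ (All.map (ImageUpTo-mono j≤p ∘ Equivalence.to (image-ins γ-perm j≤m)) img) ((j , j≤p , refl) ∷ [])

  -- The first insertion must produce the value of largest index, as later insertions use smaller positions.
  insertions-Gc⁺ : ∀ k {m γ} p → IsPerm m γ → p ≤ m → ∀ vs → length vs ≡ k → All (ImageUpTo (τ γ) p) vs →
    ∃ λ w → w ∈ insertions k γ p × ∃ λ ts → Gc w ≡ ts ++ Gc γ × ts ↭ vs
  insertions-Gc⁺ zero    {γ = γ} p γ-perm p≤m [] refl [] = γ , here refl , [] , refl , refl
  insertions-Gc⁺ (suc k) {m} {γ} p γ-perm p≤m (v ∷ vs) ∣vs∣ img =
    let j , j≤p , rest , vs↭ , img′ = extractMax (τ γ) p v vs img
        j≤m = ℕ.≤-trans j≤p p≤m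
        ∣rest∣ = ℕ.suc-injective (≡-trans (sym (↭.↭-length vs↭)) ∣vs∣)
        w , w∈ , ts , Gc-w , ts↭ = insertions-Gc⁺ k j (IsPerm-ins j γ-perm) (ℕ.m≤n⇒m≤1+n j≤m) rest ∣rest∣
                                     (All.map (Equivalence.from (image-ins γ-perm j≤m)) img′)
    in w , ∈-concatMap⁺ _ (lose (∈-downFrom⁺ (s≤s j≤p)) w∈) , ts ++ [ τ γ j ] ,
       ≡-trans Gc-w (++-Gc-ins γ-perm j≤m ts) ,
       trans (↭-sym (↭.∷↭∷ʳ (τ γ j) ts)) (trans (prep (τ γ j) ts↭) (↭-sym vs↭))

  module _ (R : CommutativeSemiring 0ℓ 0ℓ) (x : ℕ → CommutativeSemiring.Carrier R) where
    open CommutativeSemiring R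
      renaming (_+_ to _⊕_; _*_ to _⊗_; refl to ≈-refl; reflexive to ≈-reflexive; sym to ≈-sym; trans to ≈-trans)
    open Poly R using (sumL; mono; h)
    open CompleteHomogeneous R
    open import Relation.Binary.Reasoning.Setoid setoid

    complete-ins : ∀ {m γ} → IsPerm m γ → ∀ {j} → j ≤ m → ∀ k →
      complete k (map (x ∘ τ (ins j γ)) (downFrom (suc j))) ≈ complete k (map (x ∘ τ γ) (downFrom (suc j)))
    complete-ins {γ = γ} γ-perm {j} j≤m k = begin
      complete k (map (x ∘ τ (ins j γ)) ds)  ≡⟨ cong (complete k) (List.map-∘ ds) ⟩
      complete k (map x (map (τ (ins j γ)) ds)) ≈⟨ complete-↭ (↭.map⁺ x (τ-ins-↭ γ-perm j≤m)) k ⟩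
      complete k (map x (map (τ γ) ds))      ≡⟨ cong (complete k) (List.map-∘ ds) ⟨
      complete k (map (x ∘ τ γ) ds)          ∎
      where ds = downFrom (suc j)

    sum-insertions : ∀ k {m γ} p → IsPerm m γ → p ≤ m →
      sumL (map (mono x ∘ Gc) (insertions k γ p)) ≈ complete k (map (x ∘ τ γ) (downFrom (suc p))) ⊗ mono x (Gc γ)
    sum-insertions zero    p γ-perm p≤m = ≈-trans (+-identityʳ _) (≈-sym (*-identityˡ _))
    sum-insertions (suc k) {m} {γ} p γ-perm p≤m = begin
      sumL (map (mono x ∘ Gc) (concatMap (λ j → insertions k (ins j γ) j) ds))
        ≈⟨ sumL-concatMap (mono x ∘ Gc) (λ j → insertions k (ins j γ) j) ds ⟩
      sumL (map (λ j → sumL (map (mono x ∘ Gc) (insertions k (ins j γ) j))) ds)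
        ≈⟨ sumL-cong-∈ ds (λ j∈ → byLastInsertion (s≤s⁻¹ (∈-downFrom⁻ j∈))) ⟩
      sumL (map (λ j → x (τ γ j) ⊗ complete k (map (x ∘ τ γ) (downFrom (suc j))) ⊗ mono x (Gc γ)) ds)
        ≈⟨ sumL-*ʳ (λ j → x (τ γ j) ⊗ complete k (map (x ∘ τ γ) (downFrom (suc j)))) (mono x (Gc γ)) ds ⟩
      sumL (map (λ j → x (τ γ j) ⊗ complete k (map (x ∘ τ γ) (downFrom (suc j)))) ds) ⊗ mono x (Gc γ)
        ≈⟨ *-congʳ (complete-downFrom (x ∘ τ γ) k (suc p)) ⟨
      complete (suc k) (map (x ∘ τ γ) ds) ⊗ mono x (Gc γ) ∎
      where
      ds = downFrom (suc p)
      byLastInsertion : ∀ {j} → j ≤ p → sumL (map (mono x ∘ Gc) (insertions k (ins j γ) j)) ≈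
        x (τ γ j) ⊗ complete k (map (x ∘ τ γ) (downFrom (suc j))) ⊗ mono x (Gc γ)
      byLastInsertion {j} j≤p = begin
        sumL (map (mono x ∘ Gc) (insertions k (ins j γ) j))
          ≈⟨ sum-insertions k j (IsPerm-ins j γ-perm) (ℕ.m≤n⇒m≤1+n j≤m) ⟩
        complete k (map (x ∘ τ (ins j γ)) (downFrom (suc j))) ⊗ mono x (Gc (ins j γ))
          ≈⟨ *-cong (complete-ins γ-perm j≤m k) (≈-reflexive (cong (mono x) (Gc-ins γ-perm j≤m))) ⟩
        complete k (map (x ∘ τ γ) (downFrom (suc j))) ⊗ (x (τ γ j) ⊗ mono x (Gc γ))
          ≈⟨ *-assoc _ _ _ ⟨
        complete k (map (x ∘ τ γ) (downFrom (suc j))) ⊗ x (τ γ j) ⊗ mono x (Gc γ)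
          ≈⟨ *-congʳ (*-comm _ _) ⟩
        x (τ γ j) ⊗ complete k (map (x ∘ τ γ) (downFrom (suc j))) ⊗ mono x (Gc γ) ∎
        where j≤m = ℕ.≤-trans j≤p p≤m

    complete-τ≈h : ∀ {n β} → IsPerm n β → ∀ k → complete k (map (x ∘ τ β) (downFrom (suc n))) ≈ h k n x
    complete-τ≈h {n} {β} β-perm k = begin
      complete k (map (x ∘ τ β) (downFrom (suc n)))    ≡⟨ cong (complete k) (List.map-∘ (downFrom (suc n))) ⟩
      complete k (map x (map (τ β) (downFrom (suc n)))) ≈⟨ complete-↭ (↭.map⁺ x (τ-bijective β-perm)) k ⟩
      complete k (map x (upTo (suc n)))                ≈⟨ h≈complete x k n ⟨
      h k n x                                          ∎

    sum-idShuffle : ∀ {n β} → IsPerm n β → ∀ k →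
      sumL (map (mono x) (map Gc (idShuffle k β))) ≈ h k n x ⊗ mono x (Gc β)
    sum-idShuffle {n} {β} β-perm k = begin
      sumL (map (mono x) (map Gc (idShuffle k β)))
        ≈⟨ sumL-↭ (↭.map⁺ (mono x) (↭.map⁺ Gc (idShuffle-↭-insertions k n β (IsPerm⇒length β-perm)))) ⟩
      sumL (map (mono x) (map Gc (insertions k β n)))
        ≡⟨ cong sumL (List.map-∘ (insertions k β n)) ⟨
      sumL (map (mono x ∘ Gc) (insertions k β n))
        ≈⟨ sum-insertions k n β-perm ℕ.≤-refl ⟩
      complete k (map (x ∘ τ β) (downFrom (suc n))) ⊗ mono x (Gc β)
        ≈⟨ *-congʳ (complete-τ≈h β-perm k) ⟩
      h k n x ⊗ mono x (Gc β) ∎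

  prefix⇒bounded : ∀ {n β} → IsPerm n β → ∀ k {s} →
    (∃ λ σ → σ ∈ idShuffle k β × NondecRearr s (take k (Gc σ))) → length s ≡ k × Sorted s × All (_≤ n) s
  prefix⇒bounded {n} {β} β-perm k (σ , σ∈ , s-sorted , s↭) =
    let ts , Gc-σ , ∣ts∣ , img = insertions-Gc⁻ k n β-perm ℕ.≤-refl
                                   (↭.∈-resp-↭ (idShuffle-↭-insertions k n β (IsPerm⇒length β-perm)) σ∈)
        s↭ts = trans s↭ (↭-reflexive (≡-trans (cong (take k) Gc-σ) (take-++-length ts (Gc β) ∣ts∣)))
    in ≡-trans (↭.↭-length s↭ts) ∣ts∣ , s-sorted , ↭.All-resp-↭ (↭-sym s↭ts) (All.map bounded img)
    where
    bounded : ∀ {t} → ImageUpTo (τ β) n t → t ≤ n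
    bounded (i , i≤n , refl) = τ-≤ β-perm i≤n

  bounded⇒prefix : ∀ {n β} → IsPerm n β → ∀ k {s} →
    length s ≡ k × Sorted s × All (_≤ n) s → ∃ λ σ → σ ∈ idShuffle k β × NondecRearr s (take k (Gc σ))
  bounded⇒prefix {n} {β} β-perm k {s} (∣s∣ , s-sorted , s≤n) =
    let w , w∈ , ts , Gc-w , ts↭s = insertions-Gc⁺ k n β-perm ℕ.≤-refl s ∣s∣ (All.map (τ-surjective β-perm) s≤n)
        ∣ts∣ = ≡-trans (↭.↭-length ts↭s) ∣s∣
    in w , ↭.∈-resp-↭ (↭-sym (idShuffle-↭-insertions k n β (IsPerm⇒length β-perm))) w∈ , s-sorted ,
       trans (↭-sym ts↭s) (↭-reflexive (sym (≡-trans (cong (take k) Gc-w) (take-++-length ts (Gc β) ∣ts∣))))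

mainTheorem15 : (C : Code) → Acceptable C →
    ∀ n (β : List ℕ) → IsPerm n β → ∀ k → 1 ≤ k →
    (∀ s → (∃ λ σ → (σ ∈ idShuffle k β) × NondecRearr s (take k (Code.Gc C σ)))
           ⇔ ((length s ≡ k) × Sorted s × All (_≤ n) s))
    ×
    (∀ (R : CommutativeSemiring 0ℓ 0ℓ) (x : ℕ → CommutativeSemiring.Carrier R) →
       CommutativeSemiring._≈_ R
         (Poly.sumL R (map (Poly.mono R x) (map (Code.Gc C) (idShuffle k β))))
         (CommutativeSemiring._*_ R (Poly.h R k n x) (Poly.mono R x (Code.Gc C β))))
mainTheorem15 C acc n β β-perm k _ =
  (λ s → mk⇔ (prefix⇒bounded β-perm k) (bounded⇒prefix β-perm k)) ,
  (λ R x → sum-idShuffle R x β-perm k)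
  where open AcceptableCode C acc
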